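{- Let $r \geq 3$, $t \geq r-2$ and $m \geq 0$ be integers and let $(H,\mathcal{F})$ be an $(r,t)$-system with $|V(H)|=m$ and $|\mathcal{F}| \geq 1$. Then $$m-t \leq e(H) \leq \binom{m}{2}.$$
   Context: All graphs are finite and simple; $e(H)$ is the number of edges of $H$. For $r\ge 3$, an $r$-system is a pair $(H,\mathcal{F})$ where $H$ is a graph and $\mathcal{F}$ is a family (possibly with repeated members) of subsets of $V(H)$ such that: (i) $H$ contains no $K_r$; (ii) every $S\in\mathcal{F}$ is maximally $K_{r-1}$-free, i.e. $H[S]$ contains no $K_{r-1}$ but $H[S\cup\{v\}]$ contains a $K_{r-1}$ for every vertex $v\notin S$; (iii) for any two distinct members $S\neq T$ of $\mathcal{F}$, $H[S\cap T]$ contains a $K_{r-2}$. For $t\ge r-2$, an $(r,t)$-system is an $r$-system in which $\mathcal{F}$ has no repeated elements and every set in $\mathcal{F}$ has size exactly $t$. -}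

module Defs where

open import Data.Nat using (ℕ; _+_; _<ᵇ_; _∸_)
open import Data.Bool using (Bool; true; false; if_then_else_; _∧_)
open import Data.Fin using (Fin; toℕ)
open import Data.Fin.Subset using (Subset; _∈_; _∉_; _∩_; _∪_; ⁅_⁆; ∣_∣)
open import Data.Vec using (Vec; lookup)
open import Data.List using (List; map; allFin; length)
open import Data.Nat.ListAction using (sum)
open import Data.List.Relation.Unary.Unique.Propositional using (Unique)
import Data.List.Membership.Propositional as LM
open import Data.Product using (Σ; _×_)
open import Relation.Binary.PropositionalEquality using (_≡_; _≢_)
open import Relation.Nullary using (¬_)

record Graph (m : ℕ) : Set where
  field
    adj   : Fin m → Fin m → Bool
    sym   : ∀ i j → adj i j ≡ adj j i
    irref : ∀ i → adj i i ≡ false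
open Graph public

edges : {m : ℕ} → Graph m → ℕ
edges {m} H = sum (map (λ i → sum (map (λ j →
  if (toℕ i <ᵇ toℕ j) ∧ adj H i j then 1 else 0) (allFin m))) (allFin m))

-- H[S] contains a K_k: k pairwise adjacent vertices (hence distinct, by
-- irreflexivity), all lying in S.
HasClique : {m : ℕ} → Graph m → Subset m → ℕ → Set
HasClique {m} H S k = Σ (Vec (Fin m) k) λ v →
  (∀ i j → i ≢ j → adj H (lookup v i) (lookup v j) ≡ true) ×
  (∀ i → lookup v i ∈ S)

ContainsClique : {m : ℕ} → Graph m → ℕ → Set
ContainsClique {m} H k = Σ (Vec (Fin m) k) λ v →
  (∀ i j → i ≢ j → adj H (lookup v i) (lookup v j) ≡ true)

MaxFree : {m : ℕ} → Graph m → ℕ → Subset m → Set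
MaxFree H k S = ¬ HasClique H S k × (∀ v → v ∉ S → HasClique H (S ∪ ⁅ v ⁆) k)

-- (H, F) is an r-system (F a list, possibly with repetitions).
IsRSystem : {m : ℕ} → ℕ → Graph m → List (Subset m) → Set
IsRSystem {m} r H F =
  ¬ ContainsClique H r ×
  (∀ {S} → S LM.∈ F → MaxFree H (r ∸ 1) S) ×
  (∀ {S T} → S LM.∈ F → T LM.∈ F → S ≢ T → HasClique H (S ∩ T) (r ∸ 2))

IsRTSystem : {m : ℕ} → ℕ → ℕ → Graph m → List (Subset m) → Set
IsRTSystem {m} r t H F =
  IsRSystem r H F × Unique F × (∀ {S} → S LM.∈ F → ∣ S ∣ ≡ t)

{-# OPTIONS --safe #-}
-- Take any S ∈ F. Since S is maximally K_{r-1}-free and r - 1 ≥ 2, every vertex v ∉ S has a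
-- neighbour in S: a K_{r-1} in S ∪ {v} must contain v, and its other vertices, being adjacent
-- to v, lie in S. Hence there are at least |V ∖ S| = m - t pairs (i, j) with i ∉ S, j ∈ S and
-- i ~ j; there are at most e(H) of them, as each edge yields at most one such pair, which is
-- checked on the symmetrised double sum so that no orientation of the edges has to be chosen.
-- For the upper bound, [i < j and i ~ j] ≤ [i < j], and the latter sums to m choose 2.
module Submission where

open import Defs
open import Data.Nat using (ℕ; _≤_; _∸_)
open import Data.Nat.Combinatorics using (_C_)
open import Data.List using (List; length)
open import Data.Fin.Subset using (Subset)
open import Data.Product using (_×_)

open import Data.Nat using (zero; suc; _+_; _*_; _<ᵇ_; z≤n; s≤s)
open import Data.Nat.Properties
open import Data.Nat.Combinatorics using (nCk+nC[k+1]≡[n+1]C[k+1]; nC1≡n)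
import Data.Nat.ListAction as ListAction
open import Data.Bool using (Bool; true; false; if_then_else_; _∧_; not; T)
open import Data.Fin using (Fin; zero; suc; toℕ; punchIn)
open import Data.Fin.Properties using (¬∀⟶∃¬; toℕ-injective; punchInᵢ≢i)
open import Data.Fin.Subset using (_∈_; _∉_; _∪_; ⁅_⁆; ∣_∣; ∁)
open import Data.Fin.Subset.Properties using (_∈?_; x∈p∪q⁻; x∈⁅y⁆⇒x≡y; ∣∁p∣≡n∸∣p∣)
open import Data.Vec using (lookup; _∷_; [])
open import Data.Vec.Properties using ([]=⇒lookup; lookup-map)
open import Data.List using (_∷_; map; allFin; tabulate)
open import Data.List.Relation.Unary.Any using (here)
open import Data.Product using (∃; _,_)
open import Data.Sum using (_⊎_; inj₁; inj₂)
import Data.Sum as Sum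
open import Relation.Binary using (tri<; tri≈; tri>)
open import Relation.Binary.PropositionalEquality
  using (_≡_; _≢_; refl; trans; cong; cong₂; subst; module ≡-Reasoning)
  renaming (sym to ≡-sym)
open import Relation.Nullary using (contradiction)
open import Algebra.Properties.CommutativeMonoid.Sum +-0-commutativeMonoid
  using (sum-syntax; sum-cong-≗; ∑-distrib-+; ∑-comm; sum-remove)

sum-map-tabulate : ∀ {A : Set} {n} (g : Fin n → A) (f : A → ℕ) →
  ListAction.sum (map f (tabulate g)) ≡ ∑[ i < n ] f (g i)
sum-map-tabulate {n = zero}  g f = refl
sum-map-tabulate {n = suc n} g f = cong (f (g zero) +_) (sum-map-tabulate (λ i → g (suc i)) f)

∑-mono-≤ : ∀ {n} {f g : Fin n → ℕ} → (∀ i → f i ≤ g i) → ∑[ i < n ] f i ≤ ∑[ i < n ] g i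
∑-mono-≤ {zero}  f≤g = z≤n
∑-mono-≤ {suc n} f≤g = +-mono-≤ (f≤g _) (∑-mono-≤ (λ i → f≤g (suc i)))

term≤∑ : ∀ {n} (f : Fin n → ℕ) i → f i ≤ ∑[ j < n ] f j
term≤∑ {suc n} f i = ≤-trans (m≤m+n (f i) _) (≤-reflexive (≡-sym (sum-remove {i = i} f)))

∑1≡n : ∀ n → ∑[ i < n ] 1 ≡ n
∑1≡n zero    = refl
∑1≡n (suc n) = cong suc (∑1≡n n)

∑∑ : ∀ {n} → (Fin n → Fin n → ℕ) → ℕ
∑∑ {n} f = ∑[ i < n ] ∑[ j < n ] f i j

∑∑-symmetrised : ∀ {n} (f : Fin n → Fin n → ℕ) → ∑∑ (λ i j → f i j + f j i) ≡ 2 * ∑∑ f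
∑∑-symmetrised {n} f = begin
  ∑[ i < n ] ∑[ j < n ] (f i j + f j i)             ≡⟨ sum-cong-≗ (λ i → ∑-distrib-+ (f i) (λ j → f j i)) ⟩
  ∑[ i < n ] (∑[ j < n ] f i j + ∑[ j < n ] f j i)  ≡⟨ ∑-distrib-+ (λ i → ∑[ j < n ] f i j) _ ⟩
  ∑∑ f + ∑∑ (λ i j → f j i)                         ≡⟨ cong (∑∑ f +_) (∑-comm (λ j i → f j i)) ⟨
  ∑∑ f + ∑∑ f                                       ≡⟨ cong (∑∑ f +_) (+-identityʳ (∑∑ f)) ⟨
  2 * ∑∑ f                                          ∎
  where open ≡-Reasoning

∑∑-mono-≤-symmetrised : ∀ {n} (f g : Fin n → Fin n → ℕ) →
  (∀ i j → f i j + f j i ≤ g i j + g j i) → ∑∑ f ≤ ∑∑ g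
∑∑-mono-≤-symmetrised f g f≤g = *-cancelˡ-≤ 2 (begin
  2 * ∑∑ f                         ≡⟨ ∑∑-symmetrised f ⟨
  ∑∑ (λ i j → f i j + f j i)       ≤⟨ ∑-mono-≤ (λ i → ∑-mono-≤ (f≤g i)) ⟩
  ∑∑ (λ i j → g i j + g j i)       ≡⟨ ∑∑-symmetrised g ⟩
  2 * ∑∑ g                         ∎)
  where open ≤-Reasoning

𝟙 : Bool → ℕ
𝟙 b = if b then 1 else 0

𝟙-∧-≤ˡ : ∀ a b → 𝟙 (a ∧ b) ≤ 𝟙 a
𝟙-∧-≤ˡ false b     = z≤n
𝟙-∧-≤ˡ true  false = z≤n
𝟙-∧-≤ˡ true  true  = ≤-refl

𝟙-∧-T : ∀ {a} b → T a → 𝟙 (a ∧ b) ≡ 𝟙 b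
𝟙-∧-T {true} b _ = refl

∣p∣≡∑𝟙 : ∀ {n} (p : Subset n) → ∣ p ∣ ≡ ∑[ i < n ] 𝟙 (lookup p i)
∣p∣≡∑𝟙 []          = refl
∣p∣≡∑𝟙 (true  ∷ p) = cong suc (∣p∣≡∑𝟙 p)
∣p∣≡∑𝟙 (false ∷ p) = ∣p∣≡∑𝟙 p

∑∑-<ᵇ≡C2 : ∀ n → ∑∑ (λ (i j : Fin n) → 𝟙 (toℕ i <ᵇ toℕ j)) ≡ n C 2
∑∑-<ᵇ≡C2 zero    = refl
∑∑-<ᵇ≡C2 (suc n) = begin
  -- row 0 has a 1 in every column but the first; row i+1 is row i of the case n
  ∑[ j < n ] 1 + ∑∑ (λ (i j : Fin n) → 𝟙 (toℕ i <ᵇ toℕ j)) ≡⟨ cong₂ _+_ (∑1≡n n) (∑∑-<ᵇ≡C2 n) ⟩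
  n + n C 2                                                ≡⟨ cong (_+ n C 2) (nC1≡n n) ⟨
  n C 1 + n C 2                                            ≡⟨ nCk+nC[k+1]≡[n+1]C[k+1] n 1 ⟩
  suc n C 2                                                ∎
  where open ≡-Reasoning

module _ {m : ℕ} (H : Graph m) where

  ordered-edge : Fin m → Fin m → ℕ
  ordered-edge i j = 𝟙 ((toℕ i <ᵇ toℕ j) ∧ adj H i j)

  edges≡∑∑ : edges H ≡ ∑∑ ordered-edge
  edges≡∑∑ = trans
    (sum-map-tabulate {n = m} (λ i → i) (λ i → ListAction.sum (map (ordered-edge i) (allFin m))))
    (sum-cong-≗ (λ i → sum-map-tabulate (λ j → j) (ordered-edge i)))

  edges≤C2 : edges H ≤ m C 2
  edges≤C2 = begin
    edges H                                     ≡⟨ edges≡∑∑ ⟩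
    ∑∑ ordered-edge                             ≤⟨ ∑-mono-≤ (λ i → ∑-mono-≤ (λ j → 𝟙-∧-≤ˡ _ (adj H i j))) ⟩
    ∑∑ (λ (i j : Fin m) → 𝟙 (toℕ i <ᵇ toℕ j))  ≡⟨ ∑∑-<ᵇ≡C2 m ⟩
    m C 2                                       ∎
    where open ≤-Reasoning

  𝟙-adj≤ordered-edges : ∀ i j → 𝟙 (adj H i j) ≤ ordered-edge i j + ordered-edge j i
  𝟙-adj≤ordered-edges i j with <-cmp (toℕ i) (toℕ j)
  ... | tri< i<j _ _ = ≤-trans (≤-reflexive (≡-sym (𝟙-∧-T _ (<⇒<ᵇ i<j)))) (m≤m+n _ _)
  ... | tri> _ _ j<i rewrite Graph.sym H i j = ≤-trans (≤-reflexive (≡-sym (𝟙-∧-T _ (<⇒<ᵇ j<i)))) (m≤n+m _ _)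
  ... | tri≈ _ i≡j _ rewrite toℕ-injective i≡j | irref H j = z≤n

  crossing-edge : Subset m → Fin m → Fin m → ℕ
  crossing-edge S i j = 𝟙 (not (lookup S i) ∧ lookup S j ∧ adj H i j)

  ∑∑-crossing-edge≤edges : ∀ S → ∑∑ (crossing-edge S) ≤ edges H
  ∑∑-crossing-edge≤edges S = begin
    ∑∑ (crossing-edge S) ≤⟨ ∑∑-mono-≤-symmetrised (crossing-edge S) ordered-edge crossing≤ordered ⟩
    ∑∑ ordered-edge      ≡⟨ edges≡∑∑ ⟨
    edges H              ∎
    where
    open ≤-Reasoning
    𝟙-crossing≤ : ∀ a b e → 𝟙 (not a ∧ b ∧ e) + 𝟙 (not b ∧ a ∧ e) ≤ 𝟙 e
    𝟙-crossing≤ true  true  e = z≤n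
    𝟙-crossing≤ true  false e = ≤-refl
    𝟙-crossing≤ false true  e = ≤-reflexive (+-identityʳ (𝟙 e))
    𝟙-crossing≤ false false e = z≤n
    crossing≤ordered : ∀ i j → crossing-edge S i j + crossing-edge S j i ≤ ordered-edge i j + ordered-edge j i
    crossing≤ordered i j = begin
      crossing-edge S i j + crossing-edge S j i
        ≡⟨ cong (λ e → crossing-edge S i j + 𝟙 (not (lookup S j) ∧ lookup S i ∧ e)) (Graph.sym H j i) ⟩
      crossing-edge S i j + 𝟙 (not (lookup S j) ∧ lookup S i ∧ adj H i j)
        ≤⟨ 𝟙-crossing≤ (lookup S i) (lookup S j) (adj H i j) ⟩
      𝟙 (adj H i j)
        ≤⟨ 𝟙-adj≤ordered-edges i j ⟩
      ordered-edge i j + ordered-edge j i ∎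

  Dominates : Subset m → Set
  Dominates S = ∀ v → v ∉ S → ∃ λ u → u ∈ S × adj H v u ≡ true

  maxFree⇒dominates : ∀ k {S} → MaxFree H (2 + k) S → Dominates S
  maxFree⇒dominates k {S} (S-free , S-maximal) v v∉S with S-maximal v v∉S
  ... | w , w-clique , w⊆S∪v with ¬∀⟶∃¬ (2 + k) (λ l → lookup w l ∈ S) (λ l → lookup w l ∈? S)
                                         (λ w⊆S → S-free (w , w-clique , w⊆S))
  ... | i , wᵢ∉S = lookup w j , wⱼ∈S , subst (λ x → adj H x (lookup w j) ≡ true) wᵢ≡v (w-clique i j i≢j)
    where
    j : Fin (2 + k)
    j = punchIn i zero
    i≢j : i ≢ j
    i≢j i≡j = punchInᵢ≢i i zero (≡-sym i≡j)
    in-S-or-v : ∀ l → lookup w l ∈ S ⊎ lookup w l ≡ v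
    in-S-or-v l = Sum.map₂ (x∈⁅y⁆⇒x≡y v) (x∈p∪q⁻ S ⁅ v ⁆ (w⊆S∪v l))
    wᵢ≡v : lookup w i ≡ v
    wᵢ≡v with in-S-or-v i
    ... | inj₁ wᵢ∈S = contradiction wᵢ∈S wᵢ∉S
    ... | inj₂ wᵢ≡v = wᵢ≡v
    wⱼ∈S : lookup w j ∈ S
    wⱼ∈S with in-S-or-v j
    ... | inj₁ wⱼ∈S = wⱼ∈S
    ... | inj₂ wⱼ≡v = contradiction (trans (≡-sym (w-clique i j i≢j)) self-loop) λ ()
      where
      self-loop : adj H (lookup w i) (lookup w j) ≡ false
      self-loop = trans (cong₂ (adj H) wᵢ≡v wⱼ≡v) (irref H v)

  𝟙-outside≤crossing-edges : ∀ {S} → Dominates S → ∀ i → 𝟙 (not (lookup S i)) ≤ ∑[ j < m ] crossing-edge S i j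
  𝟙-outside≤crossing-edges {S} dom i = row-bound (lookup S i) refl
    where
    row-bound : ∀ b → lookup S i ≡ b → 𝟙 (not b) ≤ ∑[ j < m ] crossing-edge S i j
    row-bound true  _      = z≤n
    row-bound false i-out with dom i (λ i∈S → contradiction (trans (≡-sym ([]=⇒lookup i∈S)) i-out) λ ())
    ... | u , u∈S , adj-iu = ≤-trans (≤-reflexive (≡-sym crossing-iu)) (term≤∑ (crossing-edge S i) u)
      where
      crossing-iu : crossing-edge S i u ≡ 1
      crossing-iu rewrite i-out | []=⇒lookup u∈S | adj-iu = refl

  ∣∁S∣≤edges : ∀ {S} → Dominates S → ∣ ∁ S ∣ ≤ edges H
  ∣∁S∣≤edges {S} dom = begin
    ∣ ∁ S ∣                                 ≡⟨ ∣p∣≡∑𝟙 (∁ S) ⟩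
    ∑[ i < m ] 𝟙 (lookup (∁ S) i)           ≡⟨ sum-cong-≗ (λ i → cong 𝟙 (lookup-map i not S)) ⟩
    ∑[ i < m ] 𝟙 (not (lookup S i))         ≤⟨ ∑-mono-≤ (𝟙-outside≤crossing-edges dom) ⟩
    ∑∑ (crossing-edge S)                    ≤⟨ ∑∑-crossing-edge≤edges S ⟩
    edges H                                 ∎
    where open ≤-Reasoning

lemma13 : (r t m : ℕ) → 3 ≤ r → r ∸ 2 ≤ t →
    (H : Graph m) (F : List (Subset m)) → IsRTSystem r t H F → 1 ≤ length F →
    (m ∸ t ≤ edges H) × (edges H ≤ m C 2)
lemma13 (suc (suc (suc k))) t m (s≤s (s≤s (s≤s _))) _ H (S ∷ _) ((_ , maxFree , _) , _ , size≡t) _ =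
  m∸t≤edges , edges≤C2 H
  where
  open ≤-Reasoning
  m∸t≤edges : m ∸ t ≤ edges H
  m∸t≤edges = begin
    m ∸ t      ≡⟨ cong (m ∸_) (size≡t (here refl)) ⟨
    m ∸ ∣ S ∣  ≡⟨ ∣∁p∣≡n∸∣p∣ S ⟨
    ∣ ∁ S ∣    ≤⟨ ∣∁S∣≤edges H (maxFree⇒dominates H k (maxFree (here refl))) ⟩
    edges H    ∎
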